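{- For each of the fourteen sequent calculi $\mathsf{G1CL}$ described in the context, the rule $\mathsf{cut}$: from $\Gamma\Rightarrow A$ and $\Sigma,A\Rightarrow C$ infer $\Gamma,\Sigma\Rightarrow C$, is admissible in $\mathsf{G1CL}$.
   Context: Formulas: $A ::= p \mid \bot \mid A\wedge A \mid A\vee A \mid A\to A \mid \Box A \mid \Diamond A$. Sequents $\Gamma\Rightarrow\delta$: $\Gamma$ a finite multiset of formulas, $\delta$ empty or a single formula; $\Box\Sigma$ prefixes $\Box$ to each member of $\Sigma$; derivations are finite trees; admissible means: derivable premisses give a derivable conclusion. $\mathsf{G1IPL}$: initial sequents $A\Rightarrow A$ and $\bot\Rightarrow$; (L$\wedge$) $\Gamma,A_i\Rightarrow\delta$ / $\Gamma,A_1\wedge A_2\Rightarrow\delta$; (R$\wedge$) $\Gamma\Rightarrow A$, $\Gamma\Rightarrow B$ / $\Gamma\Rightarrow A\wedge B$; (L$\vee$) $\Gamma,A\Rightarrow\delta$, $\Gamma,B\Rightarrow\delta$ / $\Gamma,A\vee B\Rightarrow\delta$; (R$\vee$) $\Gamma\Rightarrow A_i$ / $\Gamma\Rightarrow A_1\vee A_2$; (R$\to$) $\Gamma,A\Rightarrow B$ / $\Gamma\Rightarrow A\to B$; (L$\to$) $\Gamma\Rightarrow A$, $\Gamma,B\Rightarrow\delta$ / $\Gamma,A\to B\Rightarrow\delta$; (LW) $\Gamma\Rightarrow\delta$ / $\Gamma,A\Rightarrow\delta$; (RW) $\Gamma\Rightarrow$ / $\Gamma\Rightarrow A$; (LC)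 $\Gamma,A,A\Rightarrow\delta$ / $\Gamma,A\Rightarrow\delta$. Modal rules: (M$\Box$) $A\Rightarrow B$ / $\Box A\Rightarrow\Box B$; (M$\Diamond$) $A\Rightarrow B$ / $\Diamond A\Rightarrow\Diamond B$; (N$\Box$) $\Rightarrow A$ / $\Rightarrow\Box A$; (C$\Box$) $\Sigma,A\Rightarrow B$ / $\Box\Sigma,\Box A\Rightarrow\Box B$; (K$\Box$) $\Sigma\Rightarrow A$ / $\Box\Sigma\Rightarrow\Box A$; (K$\Diamond$) $\Sigma,A\Rightarrow B$ / $\Box\Sigma,\Diamond A\Rightarrow\Diamond B$; (P$\Diamond$) $\Rightarrow A$ / $\Rightarrow\Diamond A$; (D) $A\Rightarrow B$ / $\Box A\Rightarrow\Diamond B$; (CD) $\Sigma\Rightarrow A$ / $\Box\Sigma\Rightarrow\Diamond A$; (iT$\Box$) $\Gamma,A\Rightarrow\delta$ / $\Gamma,\Box A\Rightarrow\delta$; (T$\Diamond$) $\Gamma\Rightarrow A$ / $\Gamma\Rightarrow\Diamond A$. The calculi are $\mathsf{G1IPL}$ plus: $\mathsf{G1CM}$: M$\Box$,M$\Diamond$; $\mathsf{G1CMP}$: $\mathsf{G1CM}$+P$\Diamond$; $\mathsf{G1CMN}$: $\mathsf{G1CM}$+N$\Box$; $\mathsf{G1CMNP}$: $\mathsf{G1CMN}$+P$\Diamond$; $\mathsf{G1CMC}$: C$\Box$,K$\Diamond$; $\mathsf{G1CK}$: K$\Box$,K$\Diamond$; $\mathsf{G1CMD}$: $\mathsf{G1CM}$+D+P$\Diamond$;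 $\mathsf{G1CMT}$: $\mathsf{G1CM}$+iT$\Box$+T$\Diamond$; $\mathsf{G1CMND}$: $\mathsf{G1CMN}$+D+P$\Diamond$; $\mathsf{G1CMNT}$: $\mathsf{G1CMN}$+iT$\Box$+T$\Diamond$; $\mathsf{G1CMCD}$: $\mathsf{G1CMC}$+CD; $\mathsf{G1CMCT}$: $\mathsf{G1CMC}$+iT$\Box$+T$\Diamond$; $\mathsf{G1CKD}$: $\mathsf{G1CK}$+CD; $\mathsf{G1CKT}$: $\mathsf{G1CK}$+iT$\Box$+T$\Diamond$. -}

module Defs where

open import Data.Nat using (ℕ)
open import Data.Bool using (Bool; true; false; T)
open import Data.List using (List; []; _∷_; map; [_])
open import Data.Maybe using (Maybe; just; nothing)
open import Data.List.Relation.Binary.Permutation.Propositional using (_↭_)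

infixr 30 _⊃_
infixr 35 _∨'_
infixr 40 _∧'_

data Fm : Set where
  atom : ℕ → Fm
  ⊥'   : Fm
  _∧'_ : Fm → Fm → Fm
  _∨'_ : Fm → Fm → Fm
  _⊃_  : Fm → Fm → Fm
  □_   : Fm → Fm
  ◇_   : Fm → Fm

-- Contexts are finite multisets, represented as lists modulo permutation
-- (the rule `exch` below makes derivability invariant under permutation).
Ctx : Set
Ctx = List Fm

-- Succedent δ: empty (nothing) or a single formula (just A).
Succ : Set
Succ = Maybe Fm

□* : Ctx → Ctx
□* Σ = map □_ Σ

data Calc : Set where
  CM CMP CMN CMNP CMC CK CMD CMT CMND CMNT CMCD CMCT CKD CKT : Calc

hasM : Calc → Bool
hasM CM   = true
hasM CMP  = true
hasM CMN  = true
hasM CMNP = true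
hasM CMD  = true
hasM CMT  = true
hasM CMND = true
hasM CMNT = true
hasM _    = false

hasP : Calc → Bool
hasP CMP  = true
hasP CMNP = true
hasP CMD  = true
hasP CMND = true
hasP _    = false

hasN : Calc → Bool
hasN CMN  = true
hasN CMNP = true
hasN CMND = true
hasN CMNT = true
hasN _    = false

hasC : Calc → Bool
hasC CMC  = true
hasC CMCD = true
hasC CMCT = true
hasC _    = false

hasK : Calc → Bool
hasK CK  = true
hasK CKD = true
hasK CKT = true
hasK _   = false

hasKD : Calc → Bool
hasKD CMC  = true
hasKD CMCD = true
hasKD CMCT = true
hasKD CK   = true
hasKD CKD  = true
hasKD CKT  = true
hasKD _    = false

hasD : Calc → Bool
hasD CMD  = true
hasD CMND = true
hasD _    = false

hasCD : Calc → Bool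
hasCD CMCD = true
hasCD CKD  = true
hasCD _    = false

hasT : Calc → Bool
hasT CMT  = true
hasT CMNT = true
hasT CMCT = true
hasT CKT  = true
hasT _    = false

-- Derivability in G1CL.  "Γ, A" is written A ∷ Γ.
data _⊢_⇒_ (L : Calc) : Ctx → Succ → Set where
  exch : ∀ {Γ Γ' δ} → Γ ↭ Γ' → L ⊢ Γ ⇒ δ → L ⊢ Γ' ⇒ δ
  ax   : ∀ {A} → L ⊢ [ A ] ⇒ just A
  ax⊥  : L ⊢ [ ⊥' ] ⇒ nothing
  L∧₁  : ∀ {Γ A B δ} → L ⊢ A ∷ Γ ⇒ δ → L ⊢ (A ∧' B) ∷ Γ ⇒ δ
  L∧₂  : ∀ {Γ A B δ} → L ⊢ B ∷ Γ ⇒ δ → L ⊢ (A ∧' B) ∷ Γ ⇒ δ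
  R∧   : ∀ {Γ A B} → L ⊢ Γ ⇒ just A → L ⊢ Γ ⇒ just B → L ⊢ Γ ⇒ just (A ∧' B)
  L∨   : ∀ {Γ A B δ} → L ⊢ A ∷ Γ ⇒ δ → L ⊢ B ∷ Γ ⇒ δ → L ⊢ (A ∨' B) ∷ Γ ⇒ δ
  R∨₁  : ∀ {Γ A B} → L ⊢ Γ ⇒ just A → L ⊢ Γ ⇒ just (A ∨' B)
  R∨₂  : ∀ {Γ A B} → L ⊢ Γ ⇒ just B → L ⊢ Γ ⇒ just (A ∨' B)
  R⊃   : ∀ {Γ A B} → L ⊢ A ∷ Γ ⇒ just B → L ⊢ Γ ⇒ just (A ⊃ B)
  L⊃   : ∀ {Γ A B δ} → L ⊢ Γ ⇒ just A → L ⊢ B ∷ Γ ⇒ δ → L ⊢ (A ⊃ B) ∷ Γ ⇒ δ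
  LW   : ∀ {Γ A δ} → L ⊢ Γ ⇒ δ → L ⊢ A ∷ Γ ⇒ δ
  RW   : ∀ {Γ A} → L ⊢ Γ ⇒ nothing → L ⊢ Γ ⇒ just A
  LC   : ∀ {Γ A δ} → L ⊢ A ∷ A ∷ Γ ⇒ δ → L ⊢ A ∷ Γ ⇒ δ
  M□   : ∀ {A B} → T (hasM L) → L ⊢ [ A ] ⇒ just B → L ⊢ [ □ A ] ⇒ just (□ B)
  M◇   : ∀ {A B} → T (hasM L) → L ⊢ [ A ] ⇒ just B → L ⊢ [ ◇ A ] ⇒ just (◇ B)
  N□   : ∀ {A} → T (hasN L) → L ⊢ [] ⇒ just A → L ⊢ [] ⇒ just (□ A)
  C□   : ∀ {Σ A B} → T (hasC L) → L ⊢ A ∷ Σ ⇒ just B → L ⊢ (□ A) ∷ □* Σ ⇒ just (□ B)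
  K□   : ∀ {Σ A} → T (hasK L) → L ⊢ Σ ⇒ just A → L ⊢ □* Σ ⇒ just (□ A)
  K◇   : ∀ {Σ A B} → T (hasKD L) → L ⊢ A ∷ Σ ⇒ just B → L ⊢ (◇ A) ∷ □* Σ ⇒ just (◇ B)
  P◇   : ∀ {A} → T (hasP L) → L ⊢ [] ⇒ just A → L ⊢ [] ⇒ just (◇ A)
  D    : ∀ {A B} → T (hasD L) → L ⊢ [ A ] ⇒ just B → L ⊢ [ □ A ] ⇒ just (◇ B)
  CD   : ∀ {Σ A} → T (hasCD L) → L ⊢ Σ ⇒ just A → L ⊢ □* Σ ⇒ just (◇ A)
  iT□  : ∀ {Γ A δ} → T (hasT L) → L ⊢ A ∷ Γ ⇒ δ → L ⊢ (□ A) ∷ Γ ⇒ δ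
  T◇   : ∀ {Γ A} → T (hasT L) → L ⊢ Γ ⇒ just A → L ⊢ Γ ⇒ just (◇ A)

{-# OPTIONS --safe #-}
-- Cut is proved in Gentzen's form of mix: the left premiss Γ ⇒ A is cut against every occurrence
-- of A in the antecedent of the right premiss at once, so contraction on the cut formula is
-- harmless (antecedents matter only as sets, thanks to exchange, weakening and contraction).
-- The induction is on A, then on the left derivation until it ends by introducing A on the
-- right, then on the right derivation.  A principal cut is replaced by mixes on immediate
-- subformulas; in the modal cases the reduct is closed by the modal rule of one of the two
-- premisses, and the combinations for which neither applies never occur in the same calculus.
-- Cuts on a boxed formula in the boxed context of K□, CD, K◇ or C□ are pushed into the
-- premiss, where the formula is unboxed.
module Submission where

open import Defs
open import Data.List using (_++_; _∷_)
open import Data.Maybe using (just)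

open import Data.Bool using (T)
open import Data.Empty using (⊥-elim)
open import Data.List using ([]; [_])
open import Data.List.Properties using (map-++)
open import Data.Maybe using (nothing)
open import Data.Product using (∃-syntax; _×_; _,_; proj₁; proj₂)
open import Data.Sum using (_⊎_; inj₁; inj₂)
open import Function using (_∘_)
open import Relation.Nullary using (¬_)
open import Relation.Binary.PropositionalEquality using (_≡_; refl)
open import Data.List.Membership.Propositional using (_∈_; _∉_)
open import Data.List.Membership.Propositional.Properties using (∈-map⁻; ∈-++⁺ʳ; ∈-++⁻; ∈-∃++)
open import Data.List.Relation.Unary.Any using (here; there)
open import Data.List.Relation.Binary.Subset.Propositional using (_⊆_)
open import Data.List.Relation.Binary.Subset.Propositional.Properties
  using (⊆-refl; ⊆-trans; ⊆-reflexive; ⊆-reflexive-↭; xs⊆x∷xs; ∷⁺ʳ; ∈-∷⁺ʳ; ⊆∷⇒∈∨⊆; ⊆∷∧∉⇒⊆;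
         xs⊆xs++ys; xs⊆ys++xs; ++⁺ʳ)
open import Data.List.Relation.Binary.Permutation.Propositional using (prep; ↭-sym)
open import Data.List.Relation.Binary.Permutation.Propositional.Properties
  using (∈-resp-↭; shift; ++-comm) renaming (++⁺ʳ to ↭-++⁺ʳ)

variable
  L : Calc
  Γ Γ₁ Δ Θ Θ′ Ξ Π Σ Σ′ Φ Ψ : Ctx
  A B F X Y : Fm
  δ δ′ : Succ

++-lub : Θ ⊆ Ξ → Θ′ ⊆ Ξ → Θ ++ Θ′ ⊆ Ξ
++-lub {Θ = Θ} p q m with ∈-++⁻ Θ m
... | inj₁ m′ = p m′
... | inj₂ m′ = q m′

singleton-⊆ : F ∈ Θ → [ F ] ⊆ Θ
singleton-⊆ m = ∈-∷⁺ʳ m (λ ())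

⊆-push : Θ ⊆ A ∷ Σ → F ∷ Θ ⊆ A ∷ F ∷ Σ
⊆-push {Σ = Σ} {F = F} s = ∈-∷⁺ʳ (there (here refl)) (⊆-trans s (∷⁺ʳ _ (xs⊆x∷xs Σ F)))

shift-⊆ : ∀ Γ → Γ ++ F ∷ Σ ⊆ F ∷ Γ ++ Σ
shift-⊆ {F = F} {Σ = Σ} Γ = ⊆-reflexive-↭ (shift F Γ Σ)

□*-++-⊆ : ∀ Γ₁ → □* Σ′ ⊆ Σ → □* (Γ₁ ++ Σ′) ⊆ □* Γ₁ ++ Σ
□*-++-⊆ {Σ′ = Σ′} Γ₁ s = ⊆-trans (⊆-reflexive (map-++ □_ Γ₁ Σ′)) (++⁺ʳ (□* Γ₁) s)

◇∉□* : ◇ X ∉ □* Ξ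
◇∉□* m with ∈-map⁻ □_ m
... | _ , _ , ()

□*-⊆-∷ : □* Ξ ⊆ A ∷ Σ → □* Ξ ⊆ Σ ⊎ ∃[ Y ] A ≡ □ Y
□*-⊆-∷ s with ⊆∷⇒∈∨⊆ s
... | inj₂ □Ξ⊆Σ = inj₁ □Ξ⊆Σ
... | inj₁ A∈□Ξ with ∈-map⁻ □_ A∈□Ξ
...   | Y , _ , A≡□Y = inj₂ (Y , A≡□Y)

□*-⊆-□∷ : ∀ Ξ → □* Ξ ⊆ □ Y ∷ Σ → ∃[ Σ′ ] Ξ ⊆ Y ∷ Σ′ × □* Σ′ ⊆ Σ
□*-⊆-□∷ [] _ = [] , (λ ()) , (λ ())
□*-⊆-□∷ (X ∷ Ξ) s with □*-⊆-□∷ Ξ (s ∘ there) | s (here refl)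
... | Σ′ , Ξ⊆ , □Σ′⊆ | here refl   = Σ′ , ∈-∷⁺ʳ (here refl) Ξ⊆ , □Σ′⊆
... | Σ′ , Ξ⊆ , □Σ′⊆ | there □X∈Σ = X ∷ Σ′ , ⊆-push Ξ⊆ , ∈-∷⁺ʳ □X∈Σ □Σ′⊆

weakenˡ : ∀ Ξ → L ⊢ Θ ⇒ δ → L ⊢ Ξ ++ Θ ⇒ δ
weakenˡ []      d = d
weakenˡ (_ ∷ Ξ) d = LW (weakenˡ Ξ d)

weakenʳ : ∀ Ξ → L ⊢ Θ ⇒ δ → L ⊢ Θ ++ Ξ ⇒ δ
weakenʳ {Θ = Θ} Ξ d = exch (++-comm Ξ Θ) (weakenˡ Ξ d)

weakenᴿ : L ⊢ Θ ⇒ nothing → L ⊢ Θ ⇒ δ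
weakenᴿ {δ = nothing} d = d
weakenᴿ {δ = just _}  d = RW d

to-front : ∀ Γ → L ⊢ Γ ++ F ∷ Σ ⇒ δ → L ⊢ F ∷ Γ ++ Σ ⇒ δ
to-front {F = F} {Σ = Σ} Γ = exch (shift F Γ Σ)

contract-∈ : F ∈ Θ → L ⊢ F ∷ Θ ⇒ δ → L ⊢ Θ ⇒ δ
contract-∈ {F = F} m d with ∈-∃++ m
... | Θ₁ , Θ₂ , refl = exch (↭-sym (shift F Θ₁ Θ₂)) (LC (exch (prep F (shift F Θ₁ Θ₂)) d))

⊢-resp-⊆ : Θ ⊆ Θ′ → L ⊢ Θ ⇒ δ → L ⊢ Θ′ ⇒ δ
⊢-resp-⊆ {Θ′ = Θ′} s d = contract-prefix s (weakenʳ Θ′ d)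
  where
  contract-prefix : Θ ⊆ Θ′ → L ⊢ Θ ++ Θ′ ⇒ δ → L ⊢ Θ′ ⇒ δ
  contract-prefix {Θ = []}    _ d = d
  contract-prefix {Θ = F ∷ Θ} s d =
    contract-prefix (s ∘ there) (contract-∈ (∈-++⁺ʳ Θ (s (here refl))) d)

weaken-⊆ : Δ ⊆ Σ → L ⊢ Δ ⇒ δ → L ⊢ Γ ++ Σ ⇒ δ
weaken-⊆ {Σ = Σ} {Γ = Γ} s = ⊢-resp-⊆ (⊆-trans s (xs⊆ys++xs Σ Γ))

iT□-⋆ : T (hasT L) → ∀ Ξ → L ⊢ Θ ++ Ξ ⇒ δ → L ⊢ Θ ++ □* Ξ ⇒ δ
iT□-⋆ h []      d = d
iT□-⋆ {Θ = Θ} h (X ∷ Ξ) d =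
  exch (↭-sym (shift (□ X) Θ (□* Ξ))) (iT□ h (iT□-⋆ {Θ = X ∷ Θ} h Ξ (to-front Θ d)))

data _⊏_ : Fm → Fm → Set where
  ∧ˡ : X ⊏ (X ∧' Y)
  ∧ʳ : Y ⊏ (X ∧' Y)
  ∨ˡ : X ⊏ (X ∨' Y)
  ∨ʳ : Y ⊏ (X ∨' Y)
  ⊃ˡ : X ⊏ (X ⊃ Y)
  ⊃ʳ : Y ⊏ (X ⊃ Y)
  □ˢ : X ⊏ (□ X)
  ◇ˢ : X ⊏ (◇ X)

Mix : Calc → Fm → Set
Mix L A = ∀ {Γ Δ Σ δ} → L ⊢ Γ ⇒ just A → L ⊢ Δ ⇒ δ → Δ ⊆ A ∷ Σ → L ⊢ Γ ++ Σ ⇒ δ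

mix-⊆ : Mix L A → L ⊢ Γ ⇒ just A → L ⊢ Δ ⇒ δ → Γ ⊆ Θ → Δ ⊆ A ∷ Θ → L ⊢ Θ ⇒ δ
mix-⊆ mixA d e Γ⊆Θ Δ⊆A∷Θ = ⊢-resp-⊆ (++-lub Γ⊆Θ ⊆-refl) (mixA d e Δ⊆A∷Θ)

-- `rule` is the modal rule of the right premiss, re-applied to the reduct; Φ and Ψ are the
-- unboxed parts of its premiss and conclusion (X and ◇X for K◇, X and □X for C□).
boxed-cut : Mix L Y → L ⊢ Γ₁ ⇒ just Y → L ⊢ Φ ++ Ξ ⇒ δ → □* Ξ ⊆ □ Y ∷ Σ
          → (∀ {Π} → L ⊢ Φ ++ Γ₁ ++ Π ⇒ δ → L ⊢ Ψ ++ □* (Γ₁ ++ Π) ⇒ δ′)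
          → Ψ ⊆ □* Γ₁ ++ Σ → L ⊢ □* Γ₁ ++ Σ ⇒ δ′
boxed-cut {Γ₁ = Γ₁} {Φ = Φ} {Ξ = Ξ} mixY d e s rule Ψ⊆ with □*-⊆-□∷ Ξ s
... | Σ′ , Ξ⊆ , □Σ′⊆ =
  ⊢-resp-⊆ (++-lub Ψ⊆ (□*-++-⊆ Γ₁ □Σ′⊆)) (rule (mix-⊆ mixY d e Γ₁⊆ ΦΞ⊆))
  where
  Γ₁⊆ : Γ₁ ⊆ Φ ++ Γ₁ ++ Σ′
  Γ₁⊆ = ⊆-trans (xs⊆xs++ys Γ₁ Σ′) (xs⊆ys++xs _ Φ)
  ΦΞ⊆ : Φ ++ Ξ ⊆ _ ∷ Φ ++ Γ₁ ++ Σ′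
  ΦΞ⊆ = ++-lub (λ m → there (xs⊆xs++ys Φ _ m))
               (⊆-trans Ξ⊆ (∷⁺ʳ _ (⊆-trans (xs⊆ys++xs Σ′ Γ₁) (xs⊆ys++xs _ Φ))))

data RightIntro (L : Calc) : Ctx → Fm → Set where
  rR∧  : L ⊢ Γ ⇒ just X → L ⊢ Γ ⇒ just Y → RightIntro L Γ (X ∧' Y)
  rR∨₁ : L ⊢ Γ ⇒ just X → RightIntro L Γ (X ∨' Y)
  rR∨₂ : L ⊢ Γ ⇒ just Y → RightIntro L Γ (X ∨' Y)
  rR⊃  : L ⊢ X ∷ Γ ⇒ just Y → RightIntro L Γ (X ⊃ Y)
  rM□  : T (hasM L) → L ⊢ [ X ] ⇒ just Y → RightIntro L [ □ X ] (□ Y)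
  rM◇  : T (hasM L) → L ⊢ [ X ] ⇒ just Y → RightIntro L [ ◇ X ] (◇ Y)
  rN□  : T (hasN L) → L ⊢ [] ⇒ just X → RightIntro L [] (□ X)
  rC□  : T (hasC L) → L ⊢ X ∷ Σ ⇒ just Y → RightIntro L (□ X ∷ □* Σ) (□ Y)
  rK□  : T (hasK L) → L ⊢ Σ ⇒ just X → RightIntro L (□* Σ) (□ X)
  rK◇  : T (hasKD L) → L ⊢ X ∷ Σ ⇒ just Y → RightIntro L (◇ X ∷ □* Σ) (◇ Y)
  rP◇  : T (hasP L) → L ⊢ [] ⇒ just X → RightIntro L [] (◇ X)
  rD   : T (hasD L) → L ⊢ [ X ] ⇒ just Y → RightIntro L [ □ X ] (◇ Y)
  rCD  : T (hasCD L) → L ⊢ Σ ⇒ just X → RightIntro L (□* Σ) (◇ X)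
  rT◇  : T (hasT L) → L ⊢ Γ ⇒ just X → RightIntro L Γ (◇ X)

derivation : RightIntro L Γ A → L ⊢ Γ ⇒ just A
derivation (rR∧ d₁ d₂) = R∧ d₁ d₂
derivation (rR∨₁ d)    = R∨₁ d
derivation (rR∨₂ d)    = R∨₂ d
derivation (rR⊃ d)     = R⊃ d
derivation (rM□ h d)   = M□ h d
derivation (rM◇ h d)   = M◇ h d
derivation (rN□ h d)   = N□ h d
derivation (rC□ h d)   = C□ h d
derivation (rK□ h d)   = K□ h d
derivation (rK◇ h d)   = K◇ h d
derivation (rP◇ h d)   = P◇ h d
derivation (rD h d)    = D h d
derivation (rCD h d)   = CD h d
derivation (rT◇ h d)   = T◇ h d

⊥-not-introduced : ¬ RightIntro L Γ ⊥'
⊥-not-introduced ()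

∧-inv : RightIntro L Γ (X ∧' Y) → L ⊢ Γ ⇒ just X × L ⊢ Γ ⇒ just Y
∧-inv (rR∧ d₁ d₂) = d₁ , d₂

∨-inv : RightIntro L Γ (X ∨' Y) → L ⊢ Γ ⇒ just X ⊎ L ⊢ Γ ⇒ just Y
∨-inv (rR∨₁ d) = inj₁ d
∨-inv (rR∨₂ d) = inj₂ d

⊃-inv : RightIntro L Γ (X ⊃ Y) → L ⊢ X ∷ Γ ⇒ just Y
⊃-inv (rR⊃ d) = d

□-inv : RightIntro L Γ (□ X) → ∃[ Γ₁ ] Γ ≡ □* Γ₁ × L ⊢ Γ₁ ⇒ just X
□-inv (rM□ _ d) = _ , refl , d
□-inv (rN□ _ d) = [] , refl , d
□-inv (rC□ _ d) = _ , refl , d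
□-inv (rK□ _ d) = _ , refl , d

□-inv-T : T (hasT L) → RightIntro L Γ (□ X) → L ⊢ Γ ⇒ just X
□-inv-T h r with □-inv r
... | Γ₁ , refl , d = iT□-⋆ {Θ = []} h Γ₁ d

hasD⇒P∧¬C∧¬K : T (hasD L) → T (hasP L) × ¬ T (hasC L) × ¬ T (hasK L)
hasD⇒P∧¬C∧¬K {CMD}  _ = _ , (λ ()) , (λ ())
hasD⇒P∧¬C∧¬K {CMND} _ = _ , (λ ()) , (λ ())
hasD⇒P∧¬C∧¬K {CM}   ()
hasD⇒P∧¬C∧¬K {CMP}  ()
hasD⇒P∧¬C∧¬K {CMN}  ()
hasD⇒P∧¬C∧¬K {CMNP} ()
hasD⇒P∧¬C∧¬K {CMC}  ()
hasD⇒P∧¬C∧¬K {CK}   ()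
hasD⇒P∧¬C∧¬K {CMT}  ()
hasD⇒P∧¬C∧¬K {CMNT} ()
hasD⇒P∧¬C∧¬K {CMCD} ()
hasD⇒P∧¬C∧¬K {CMCT} ()
hasD⇒P∧¬C∧¬K {CKD}  ()
hasD⇒P∧¬C∧¬K {CKT}  ()

hasKD⇒¬P∧¬D : T (hasKD L) → ¬ T (hasP L) × ¬ T (hasD L)
hasKD⇒¬P∧¬D {CMC}  _ = (λ ()) , (λ ())
hasKD⇒¬P∧¬D {CK}   _ = (λ ()) , (λ ())
hasKD⇒¬P∧¬D {CMCD} _ = (λ ()) , (λ ())
hasKD⇒¬P∧¬D {CMCT} _ = (λ ()) , (λ ())
hasKD⇒¬P∧¬D {CKD}  _ = (λ ()) , (λ ())
hasKD⇒¬P∧¬D {CKT}  _ = (λ ()) , (λ ())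
hasKD⇒¬P∧¬D {CM}   ()
hasKD⇒¬P∧¬D {CMP}  ()
hasKD⇒¬P∧¬D {CMN}  ()
hasKD⇒¬P∧¬D {CMNP} ()
hasKD⇒¬P∧¬D {CMD}  ()
hasKD⇒¬P∧¬D {CMT}  ()
hasKD⇒¬P∧¬D {CMND} ()
hasKD⇒¬P∧¬D {CMNT} ()

hasC⇒¬N : T (hasC L) → ¬ T (hasN L)
hasC⇒¬N {CMC}  _ ()
hasC⇒¬N {CMCD} _ ()
hasC⇒¬N {CMCT} _ ()
hasC⇒¬N {CM}   ()
hasC⇒¬N {CMP}  ()
hasC⇒¬N {CMN}  ()
hasC⇒¬N {CMNP} ()
hasC⇒¬N {CK}   ()
hasC⇒¬N {CMD}  ()
hasC⇒¬N {CMT}  ()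
hasC⇒¬N {CMND} ()
hasC⇒¬N {CMNT} ()
hasC⇒¬N {CKD}  ()
hasC⇒¬N {CKT}  ()

module Reduction {L : Calc} {A : Fm} (ih : ∀ {B} → B ⊏ A → Mix L B) where

  cut-unary : B ⊏ A → L ⊢ Π ⇒ just B → L ⊢ [ B ] ⇒ δ → L ⊢ Π ⇒ δ
  cut-unary {Π = Π} p d e = mix-⊆ (ih p) d e ⊆-refl (xs⊆xs++ys [ _ ] Π)

  cut-shared : ∀ Γ → B ⊏ A → L ⊢ Γ ⇒ just B → L ⊢ Γ ++ B ∷ Σ ⇒ δ → L ⊢ Γ ++ Σ ⇒ δ
  cut-shared {Σ = Σ} Γ p d e = mix-⊆ (ih p) d e (xs⊆xs++ys Γ Σ) (shift-⊆ Γ)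

  mix-□* : RightIntro L Γ A → L ⊢ Φ ++ Ξ ⇒ δ → □* Ξ ⊆ A ∷ Σ
         → (∀ {Π} → L ⊢ Φ ++ Π ⇒ δ → L ⊢ Ψ ++ □* Π ⇒ δ′) → Ψ ⊆ Γ ++ Σ → L ⊢ Γ ++ Σ ⇒ δ′
  mix-□* {Γ = Γ} {Σ = Σ} r e s rule Ψ⊆ with □*-⊆-∷ s
  ... | inj₁ □Ξ⊆Σ = ⊢-resp-⊆ (++-lub Ψ⊆ (⊆-trans □Ξ⊆Σ (xs⊆ys++xs Σ Γ))) (rule e)
  ... | inj₂ (_ , refl) with □-inv r
  ...   | Γ₁ , refl , d = boxed-cut (ih □ˢ) d e s (λ {Π} → rule {Γ₁ ++ Π}) Ψ⊆

  mix-M□ : T (hasM L) → RightIntro L Γ A → L ⊢ [ X ] ⇒ just B → □ X ∈ A ∷ Σ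
         → L ⊢ Γ ++ Σ ⇒ just (□ B)
  mix-M□ h r          e (there m)   = weaken-⊆ (singleton-⊆ m) (M□ h e)
  mix-M□ h (rM□ _ d)  e (here refl) = weakenʳ _ (M□ h (cut-unary □ˢ d e))
  mix-M□ h (rN□ h′ d) e (here refl) = weakenʳ _ (N□ h′ (cut-unary □ˢ d e))
  mix-M□ h (rC□ h′ d) e (here refl) = weakenʳ _ (C□ h′ (cut-unary □ˢ d e))
  mix-M□ h (rK□ h′ d) e (here refl) = weakenʳ _ (K□ h′ (cut-unary □ˢ d e))

  mix-M◇ : T (hasM L) → RightIntro L Γ A → L ⊢ [ X ] ⇒ just B → ◇ X ∈ A ∷ Σ
         → L ⊢ Γ ++ Σ ⇒ just (◇ B)
  mix-M◇ h r          e (there m)   = weaken-⊆ (singleton-⊆ m) (M◇ h e)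
  mix-M◇ h (rM◇ _ d)  e (here refl) = weakenʳ _ (M◇ h (cut-unary ◇ˢ d e))
  mix-M◇ h (rK◇ h′ d) e (here refl) = weakenʳ _ (K◇ h′ (cut-unary ◇ˢ d e))
  mix-M◇ h (rP◇ h′ d) e (here refl) = weakenʳ _ (P◇ h′ (cut-unary ◇ˢ d e))
  mix-M◇ h (rD h′ d)  e (here refl) = weakenʳ _ (D h′ (cut-unary ◇ˢ d e))
  mix-M◇ h (rCD h′ d) e (here refl) = weakenʳ _ (CD h′ (cut-unary ◇ˢ d e))
  mix-M◇ h (rT◇ h′ d) e (here refl) = weakenʳ _ (T◇ h′ (cut-unary ◇ˢ d e))

  mix-D : T (hasD L) → RightIntro L Γ A → L ⊢ [ X ] ⇒ just B → □ X ∈ A ∷ Σ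
        → L ⊢ Γ ++ Σ ⇒ just (◇ B)
  mix-D h r          e (there m)   = weaken-⊆ (singleton-⊆ m) (D h e)
  mix-D h (rM□ _ d)  e (here refl) = weakenʳ _ (D h (cut-unary □ˢ d e))
  mix-D h (rN□ _ d)  e (here refl) = weakenʳ _ (P◇ (proj₁ (hasD⇒P∧¬C∧¬K h)) (cut-unary □ˢ d e))
  mix-D h (rC□ h′ _) e (here refl) = ⊥-elim (proj₁ (proj₂ (hasD⇒P∧¬C∧¬K h)) h′)
  mix-D h (rK□ h′ _) e (here refl) = ⊥-elim (proj₂ (proj₂ (hasD⇒P∧¬C∧¬K h)) h′)

  mix-C□ : T (hasC L) → RightIntro L Γ A → L ⊢ X ∷ Ξ ⇒ just B → □ X ∷ □* Ξ ⊆ A ∷ Σ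
         → L ⊢ Γ ++ Σ ⇒ just (□ B)
  mix-C□ {Γ = Γ} h r e s with s (here refl)
  ... | there m = mix-□* {Φ = [ _ ]} {Ψ = [ _ ]} r e (s ∘ there) (C□ h) (singleton-⊆ (∈-++⁺ʳ Γ m))
  ... | here refl with r
  ...   | rN□ h′ _ = ⊥-elim (hasC⇒¬N h h′)
  ...   | rM□ _ d  = boxed-cut {Φ = []} {Ψ = []} (ih □ˢ) d e s (C□ h) (λ ())
  ...   | rC□ _ d  = boxed-cut {Φ = []} {Ψ = []} (ih □ˢ) d e s (C□ h) (λ ())
  ...   | rK□ h′ d = boxed-cut {Φ = []} {Ψ = []} (ih □ˢ) d e s (K□ h′) (λ ())

  mix-K◇ : T (hasKD L) → RightIntro L Γ A → L ⊢ X ∷ Ξ ⇒ just B → ◇ X ∷ □* Ξ ⊆ A ∷ Σ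
         → L ⊢ Γ ++ Σ ⇒ just (◇ B)
  mix-K◇ {Γ = Γ} {X = X} {Ξ = Ξ} {B = B} {Σ = Σ} h r e s with s (here refl)
  ... | there m = mix-□* {Φ = [ _ ]} {Ψ = [ _ ]} r e (s ∘ there) (K◇ h) (singleton-⊆ (∈-++⁺ʳ Γ m))
  ... | here refl = principal r (⊆∷∧∉⇒⊆ (s ∘ there) ◇∉□*)
    where
    principal : RightIntro L Γ (◇ X) → □* Ξ ⊆ Σ → L ⊢ Γ ++ Σ ⇒ just (◇ B)
    principal (rP◇ h′ _) _ = ⊥-elim (proj₁ (hasKD⇒¬P∧¬D h) h′)
    principal (rD h′ _)  _ = ⊥-elim (proj₂ (hasKD⇒¬P∧¬D h) h′)
    principal (rM◇ _ d) □Ξ⊆Σ =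
      ⊢-resp-⊆ (∷⁺ʳ _ □Ξ⊆Σ) (K◇ h (mix-⊆ (ih ◇ˢ) d e (xs⊆xs++ys [ _ ] Ξ) (∷⁺ʳ _ (xs⊆x∷xs Ξ _))))
    principal (rK◇ {Σ = Γ₁} _ d) □Ξ⊆Σ =
      ⊢-resp-⊆ (∷⁺ʳ _ (□*-++-⊆ Γ₁ □Ξ⊆Σ))
        (K◇ h (mix-⊆ (ih ◇ˢ) d e (xs⊆xs++ys (_ ∷ Γ₁) Ξ) (∷⁺ʳ _ (xs⊆ys++xs Ξ (_ ∷ Γ₁)))))
    principal (rCD {Σ = Γ₁} h′ d) □Ξ⊆Σ =
      ⊢-resp-⊆ (□*-++-⊆ Γ₁ □Ξ⊆Σ)
        (CD h′ (mix-⊆ (ih ◇ˢ) d e (xs⊆xs++ys Γ₁ Ξ) (∷⁺ʳ _ (xs⊆ys++xs Ξ Γ₁))))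
    principal (rT◇ h′ d) □Ξ⊆Σ =
      T◇ h′ (mix-⊆ (ih ◇ˢ) d (iT□-⋆ {Θ = [ _ ]} h′ Ξ e) (xs⊆xs++ys Γ Σ)
                   (∷⁺ʳ _ (⊆-trans □Ξ⊆Σ (xs⊆ys++xs Σ Γ))))

  mix-L∧₁ : RightIntro L Γ A → X ∧' Y ∈ A ∷ Σ → L ⊢ Γ ++ X ∷ Σ ⇒ δ → L ⊢ Γ ++ Σ ⇒ δ
  mix-L∧₁ {Γ = Γ} r (here refl) e = cut-shared Γ ∧ˡ (proj₁ (∧-inv r)) e
  mix-L∧₁ {Γ = Γ} r (there m)   e = contract-∈ (∈-++⁺ʳ Γ m) (L∧₁ (to-front Γ e))

  mix-L∧₂ : RightIntro L Γ A → X ∧' Y ∈ A ∷ Σ → L ⊢ Γ ++ Y ∷ Σ ⇒ δ → L ⊢ Γ ++ Σ ⇒ δ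
  mix-L∧₂ {Γ = Γ} r (here refl) e = cut-shared Γ ∧ʳ (proj₂ (∧-inv r)) e
  mix-L∧₂ {Γ = Γ} r (there m)   e = contract-∈ (∈-++⁺ʳ Γ m) (L∧₂ (to-front Γ e))

  mix-L∨ : RightIntro L Γ A → X ∨' Y ∈ A ∷ Σ → L ⊢ Γ ++ X ∷ Σ ⇒ δ → L ⊢ Γ ++ Y ∷ Σ ⇒ δ
         → L ⊢ Γ ++ Σ ⇒ δ
  mix-L∨ {Γ = Γ} r (there m) e₁ e₂ = contract-∈ (∈-++⁺ʳ Γ m) (L∨ (to-front Γ e₁) (to-front Γ e₂))
  mix-L∨ {Γ = Γ} r (here refl) e₁ e₂ with ∨-inv r
  ... | inj₁ d = cut-shared Γ ∨ˡ d e₁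
  ... | inj₂ d = cut-shared Γ ∨ʳ d e₂

  mix-L⊃ : RightIntro L Γ A → X ⊃ Y ∈ A ∷ Σ → L ⊢ Γ ++ Σ ⇒ just X → L ⊢ Γ ++ Y ∷ Σ ⇒ δ
         → L ⊢ Γ ++ Σ ⇒ δ
  mix-L⊃ {Γ = Γ} r (there m) e₁ e₂ = contract-∈ (∈-++⁺ʳ Γ m) (L⊃ e₁ (to-front Γ e₂))
  mix-L⊃ {Γ = Γ} {Σ = Σ} r (here refl) e₁ e₂ =
    mix-⊆ (ih ⊃ʳ) (mix-⊆ (ih ⊃ˡ) e₁ (⊃-inv r) ⊆-refl (∷⁺ʳ _ (xs⊆xs++ys Γ Σ))) e₂ ⊆-refl (shift-⊆ Γ)

  mix-iT□ : T (hasT L) → RightIntro L Γ A → □ X ∈ A ∷ Σ → L ⊢ Γ ++ X ∷ Σ ⇒ δ → L ⊢ Γ ++ Σ ⇒ δ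
  mix-iT□ {Γ = Γ} h r (here refl) e = cut-shared Γ □ˢ (□-inv-T h r) e
  mix-iT□ {Γ = Γ} h r (there m)   e = contract-∈ (∈-++⁺ʳ Γ m) (iT□ h (to-front Γ e))

  mixR : RightIntro L Γ A → L ⊢ Δ ⇒ δ → Δ ⊆ A ∷ Σ → L ⊢ Γ ++ Σ ⇒ δ
  mixR r (exch q e) s = mixR r e (s ∘ ∈-resp-↭ q)
  mixR r ax s with s (here refl)
  ... | here refl = weakenʳ _ (derivation r)
  ... | there m   = weaken-⊆ (singleton-⊆ m) ax
  mixR r ax⊥ s with s (here refl)
  ... | here refl = ⊥-elim (⊥-not-introduced r)
  ... | there m   = weaken-⊆ (singleton-⊆ m) ax⊥
  mixR r (L∧₁ e)    s = mix-L∧₁ r (s (here refl)) (mixR r e (⊆-push (s ∘ there)))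
  mixR r (L∧₂ e)    s = mix-L∧₂ r (s (here refl)) (mixR r e (⊆-push (s ∘ there)))
  mixR r (L∨ e₁ e₂) s =
    mix-L∨ r (s (here refl)) (mixR r e₁ (⊆-push (s ∘ there))) (mixR r e₂ (⊆-push (s ∘ there)))
  mixR r (L⊃ e₁ e₂) s =
    mix-L⊃ r (s (here refl)) (mixR r e₁ (s ∘ there)) (mixR r e₂ (⊆-push (s ∘ there)))
  mixR r (iT□ h e)  s = mix-iT□ h r (s (here refl)) (mixR r e (⊆-push (s ∘ there)))
  mixR r (LW e)     s = mixR r e (s ∘ there)
  mixR r (LC e)     s = mixR r e (∈-∷⁺ʳ (s (here refl)) s)
  mixR r (RW e)     s = RW (mixR r e s)
  mixR r (R∧ e₁ e₂) s = R∧ (mixR r e₁ s) (mixR r e₂ s)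
  mixR r (R∨₁ e)    s = R∨₁ (mixR r e s)
  mixR r (R∨₂ e)    s = R∨₂ (mixR r e s)
  mixR {Γ = Γ} r (R⊃ e) s = R⊃ (to-front Γ (mixR r e (⊆-push s)))
  mixR r (T◇ h e)   s = T◇ h (mixR r e s)
  mixR {Γ = Γ} r (N□ h e) _ = weaken-⊆ {Γ = Γ} (λ ()) (N□ h e)
  mixR {Γ = Γ} r (P◇ h e) _ = weaken-⊆ {Γ = Γ} (λ ()) (P◇ h e)
  mixR r (M□ h e)   s = mix-M□ h r e (s (here refl))
  mixR r (M◇ h e)   s = mix-M◇ h r e (s (here refl))
  mixR r (D h e)    s = mix-D h r e (s (here refl))
  mixR r (C□ h e)   s = mix-C□ h r e s
  mixR r (K◇ h e)   s = mix-K◇ h r e s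
  mixR r (K□ h e)   s = mix-□* {Φ = []} {Ψ = []} r e s (K□ h) (λ ())
  mixR r (CD h e)   s = mix-□* {Φ = []} {Ψ = []} r e s (CD h) (λ ())

  mixL : Mix L A
  mixL {Σ = Σ} (exch q d) e s = exch (↭-++⁺ʳ Σ q) (mixL d e s)
  mixL ax          e s = ⊢-resp-⊆ s e
  mixL (L∧₁ d)     e s = L∧₁ (mixL d e s)
  mixL (L∧₂ d)     e s = L∧₂ (mixL d e s)
  mixL (L∨ d₁ d₂)  e s = L∨ (mixL d₁ e s) (mixL d₂ e s)
  mixL (L⊃ d₁ d₂)  e s = L⊃ (weakenʳ _ d₁) (mixL d₂ e s)
  mixL (LW d)      e s = LW (mixL d e s)
  mixL (LC d)      e s = LC (mixL d e s)
  mixL (iT□ h d)   e s = iT□ h (mixL d e s)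
  mixL (RW d)      e s = weakenᴿ (weakenʳ _ d)
  mixL (R∧ d₁ d₂)  e s = mixR (rR∧ d₁ d₂) e s
  mixL (R∨₁ d)     e s = mixR (rR∨₁ d) e s
  mixL (R∨₂ d)     e s = mixR (rR∨₂ d) e s
  mixL (R⊃ d)      e s = mixR (rR⊃ d) e s
  mixL (M□ h d)    e s = mixR (rM□ h d) e s
  mixL (M◇ h d)    e s = mixR (rM◇ h d) e s
  mixL (N□ h d)    e s = mixR (rN□ h d) e s
  mixL (C□ h d)    e s = mixR (rC□ h d) e s
  mixL (K□ h d)    e s = mixR (rK□ h d) e s
  mixL (K◇ h d)    e s = mixR (rK◇ h d) e s
  mixL (P◇ h d)    e s = mixR (rP◇ h d) e s
  mixL (D h d)     e s = mixR (rD h d) e s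
  mixL (CD h d)    e s = mixR (rCD h d) e s
  mixL (T◇ h d)    e s = mixR (rT◇ h d) e s

mutual
  mix : ∀ A → Mix L A
  mix A = Reduction.mixL (mix-⊏ A)

  mix-⊏ : ∀ A → B ⊏ A → Mix L B
  mix-⊏ (X ∧' _) ∧ˡ = mix X
  mix-⊏ (_ ∧' Y) ∧ʳ = mix Y
  mix-⊏ (X ∨' _) ∨ˡ = mix X
  mix-⊏ (_ ∨' Y) ∨ʳ = mix Y
  mix-⊏ (X ⊃ _)  ⊃ˡ = mix X
  mix-⊏ (_ ⊃ Y)  ⊃ʳ = mix Y
  mix-⊏ (□ X)    □ˢ = mix X
  mix-⊏ (◇ X)    ◇ˢ = mix X

mainTheorem19 : (L : Calc) (Γ Σ : Ctx) (A C : Fm)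
    → L ⊢ Γ ⇒ just A → L ⊢ A ∷ Σ ⇒ just C → L ⊢ Γ ++ Σ ⇒ just C
mainTheorem19 L Γ Σ A C d e = mix A d e ⊆-refl
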